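{- In an $\alpha$-uniform NBG, let $u$ and $v$ be two vertices with the same neighbourhood, $N[u]=N[v]$. If a mass distribution $\mathbf{x}$ is an equilibrium, then $x_u=x_v$.
   Context: An $\alpha$-uniform NBG on vertices $[n]=\{1,\dots,n\}$ with total mass $r>0$ has, for a fixed $\alpha>0$ and given sets $N[i]\subseteq[n]\setminus\{i\}$ (the neighbours of $i$), cost functions $C_i(\mathbf{x})=x_i+\alpha\sum_{j\in N[i]}x_j$ on $\Delta_r(n)=\{\mathbf{x}\in\mathbb{R}^n_{\ge0}:\sum_ix_i=r\}$. An equilibrium is $\mathbf{x}\in\Delta_r(n)$ such that for all $i,j$, $x_i>0$ implies $C_i(\mathbf{x})\le C_j(\mathbf{x})$. -}

module Defs where

open import Level using (Level; _⊔_) renaming (suc to lsuc)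
open import Data.Nat using (ℕ; zero; suc)
open import Data.Fin using (Fin; zero; suc)
open import Data.Fin.Subset using (Subset; _∉_)
open import Data.Vec using (lookup)
open import Data.Bool using (if_then_else_)
open import Data.Sum using (_⊎_)
open import Data.Product using (∃)
open import Relation.Nullary using (¬_)
open import Relation.Binary using (Rel; IsStrictTotalOrder)
open import Algebra.Structures using (IsCommutativeRing)

-- An ordered field (the paper works over ℝ; ℝ is an instance).
record OrderedField (c ℓ₁ ℓ₂ : Level) : Set (lsuc (c ⊔ ℓ₁ ⊔ ℓ₂)) where
  infix  4 _≈_ _<_
  infixl 6 _+_
  infixl 7 _*_
  field
    Carrier            : Set c
    _≈_                : Rel Carrier ℓ₁
    _<_                : Rel Carrier ℓ₂
    _+_ _*_            : Carrier → Carrier → Carrier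
    -_                 : Carrier → Carrier
    0# 1#              : Carrier
    isCommutativeRing  : IsCommutativeRing _≈_ _+_ _*_ -_ 0# 1#
    isStrictTotalOrder : IsStrictTotalOrder _≈_ _<_
    0<1                : 0# < 1#
    +-monoˡ-<          : ∀ {x y} z → x < y → x + z < y + z
    *-pos              : ∀ {x y} → 0# < x → 0# < y → 0# < x * y
    inverse            : ∀ x → ¬ (x ≈ 0#) → ∃ λ y → x * y ≈ 1#

  infix 4 _≤_
  _≤_ : Rel Carrier (ℓ₁ ⊔ ℓ₂)
  x ≤ y = x < y ⊎ x ≈ y

module NBG {c ℓ₁ ℓ₂} (F : OrderedField c ℓ₁ ℓ₂) where
  open OrderedField F

  Σ : ∀ {n} → (Fin n → Carrier) → Carrier
  Σ {zero}  f = 0#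
  Σ {suc n} f = f zero + Σ (λ i → f (suc i))

  ΣOver : ∀ {n} → Subset n → (Fin n → Carrier) → Carrier
  ΣOver S x = Σ (λ j → if lookup S j then x j else 0#)

  NoSelfLoops : ∀ {n} → (Fin n → Subset n) → Set
  NoSelfLoops {n} N = ∀ (i : Fin n) → i ∉ N i

  InSimplex : ∀ {n} → Carrier → (Fin n → Carrier) → Set (ℓ₁ ⊔ ℓ₂)
  InSimplex r x = (∀ i → 0# ≤ x i) Data.Product.× (Σ x ≈ r)

  Cost : ∀ {n} → Carrier → (Fin n → Subset n) → Fin n → (Fin n → Carrier) → Carrier
  Cost α N i x = x i + α * ΣOver (N i) x

  IsEquilibrium : ∀ {n} → Carrier → Carrier → (Fin n → Subset n) → (Fin n → Carrier) → Set (ℓ₁ ⊔ ℓ₂)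
  IsEquilibrium α r N x =
    InSimplex r x Data.Product.×
    (∀ i j → 0# < x i → Cost α N i x ≤ Cost α N j x)

{-# OPTIONS --safe #-}
module Submission where

open import Defs
open import Level using (Level)
open import Data.Nat using (ℕ)
open import Data.Fin using (Fin)
open import Data.Fin.Subset using (Subset)
open import Data.Product using (_,_; proj₂)
open import Data.Sum using (inj₁; inj₂)
open import Data.Empty using (⊥-elim)
open import Relation.Nullary using (¬_)
open import Relation.Binary using (IsStrictTotalOrder; tri<; tri≈; tri>)
open import Relation.Binary.PropositionalEquality as ≡ using (_≡_)

-- Vertices with the same neighbourhood pay the same externality, so their costs differ
-- exactly by x_u − x_v. If x_u < x_v, then v carries positive mass yet strictly exceeds
-- the cost of u, contradicting equilibrium; by symmetry and trichotomy x_u ≈ x_v.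

module _ {c ℓ₁ ℓ₂} (F : OrderedField c ℓ₁ ℓ₂) where
  open OrderedField F
  open NBG F
  open IsStrictTotalOrder isStrictTotalOrder

  ≤-<-trans : ∀ {a b d} → a ≤ b → b < d → a < d
  ≤-<-trans (inj₁ a<b) b<d = trans a<b b<d
  ≤-<-trans (inj₂ a≈b) b<d = proj₂ <-resp-≈ (Eq.sym a≈b) b<d

  cost-< : ∀ {n} α (N : Fin n → Subset n) {a b : Fin n} → N a ≡ N b →
           (x : Fin n → Carrier) → x a < x b → Cost α N a x < Cost α N b x
  cost-< α N {a} N[a]≡N[b] x xa<xb
    rewrite ≡.sym N[a]≡N[b] = +-monoˡ-< (α * ΣOver (N a) x) xa<xb

  equilibrium-¬< : ∀ {n} {α r} {N : Fin n → Subset n} {a b : Fin n} → N a ≡ N b →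
                   {x : Fin n → Carrier} → IsEquilibrium α r N x → ¬ (x a < x b)
  equilibrium-¬< {α = α} {N = N} {a} {b} N[a]≡N[b] {x} ((nonneg , _) , stable) xa<xb =
    irrefl Eq.refl (≤-<-trans Cb≤Ca Ca<Cb)
    where
    Ca<Cb : Cost α N a x < Cost α N b x
    Ca<Cb = cost-< α N N[a]≡N[b] x xa<xb

    Cb≤Ca : Cost α N b x ≤ Cost α N a x
    Cb≤Ca = stable b a (≤-<-trans (nonneg a) xa<xb)

mainTheorem15 : ∀ {c ℓ₁ ℓ₂ : Level} (F : OrderedField c ℓ₁ ℓ₂) →
    (n : ℕ) (α r : OrderedField.Carrier F) →
    OrderedField._<_ F (OrderedField.0# F) α →
    OrderedField._<_ F (OrderedField.0# F) r →
    (N : Fin n → Subset n) → NBG.NoSelfLoops F N →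
    (u v : Fin n) → N u ≡ N v →
    (x : Fin n → OrderedField.Carrier F) → NBG.IsEquilibrium F α r N x →
    OrderedField._≈_ F (x u) (x v)
mainTheorem15 F n α r _ _ N _ u v N[u]≡N[v] x eq
  with IsStrictTotalOrder.compare (OrderedField.isStrictTotalOrder F) (x u) (x v)
... | tri< xu<xv _ _ = ⊥-elim (equilibrium-¬< F N[u]≡N[v] eq xu<xv)
... | tri≈ _ xu≈xv _ = xu≈xv
... | tri> _ _ xv<xu = ⊥-elim (equilibrium-¬< F (≡.sym N[u]≡N[v]) eq xv<xu)
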